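{- Let $n$ be a positive integer and let $\mathcal{A}$ be an alphabet of $k=k_v+k_c$ letters, partitioned into a set of $k_v$ "vowels" and a set of $k_c$ "consonants". Call an $n$-letter word $a_1a_2\dots a_n$ over $\mathcal{A}$ class alternating if for every $1\le i\le n-1$, exactly one of $a_i,a_{i+1}$ is a vowel (i.e., vowels and consonants alternate). If either $n$ is even, or $n$ is odd and $k_v=k_c$, then there exists a universal cycle (U-cycle) for the set of class alternating $n$-letter words over $\mathcal{A}$.
   Context: For a set $\mathcal{C}$ of $n$-letter words over an alphabet, a universal cycle (U-cycle) for $\mathcal{C}$ is a cyclic sequence $x_1x_2\dots x_N$ with $N=|\mathcal{C}|$ such that the $N$ words $x_ix_{i+1}\dots x_{i+n-1}$ ($1\le i\le N$, indices taken modulo $N$) are exactly the words of $\mathcal{C}$, each occurring exactly once. -}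

module Defs where

open import Data.Nat using (ℕ; zero; suc; _+_; _%_; _<_)
open import Data.Nat.DivMod using (_mod_)
open import Data.Fin using (Fin; toℕ; fromℕ<)
open import Data.Sum using (_⊎_; inj₁; inj₂)
open import Data.Vec using (Vec; lookup; tabulate)
open import Data.Bool using (Bool; true; false; _xor_)
open import Data.Product using (∃; _×_)
open import Relation.Binary.PropositionalEquality using (_≡_)

-- The alphabet: k_v vowels (inj₁) and k_c consonants (inj₂).
Alphabet : ℕ → ℕ → Set
Alphabet kv kc = Fin kv ⊎ Fin kc

isVowel : ∀ {kv kc} → Alphabet kv kc → Bool
isVowel (inj₁ _) = true
isVowel (inj₂ _) = false

Word : ℕ → ℕ → ℕ → Set
Word kv kc n = Vec (Alphabet kv kc) n

-- Class alternating: for every 1 ≤ i ≤ n-1 exactly one of a_i, a_{i+1} is a vowel.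
-- (0-indexed: for every i with i + 1 < n.)
ClassAlternating : ∀ {kv kc n} → Word kv kc n → Set
ClassAlternating {n = n} w =
  (i : Fin n) (j : Fin n) → toℕ j ≡ suc (toℕ i) →
  (isVowel (lookup w i) xor isVowel (lookup w j)) ≡ true

cyc : ∀ {A : Set} {N} → Vec A N → Fin N → ℕ → A
cyc {N = suc m} x i j = lookup x ((toℕ i + j) mod (suc m))

window : ∀ {A : Set} {N} (n : ℕ) → Vec A N → Fin N → Vec A n
window n x i = tabulate (λ j → cyc x i (toℕ j))

-- x (of length N) is a universal cycle for the set of words satisfying P:
-- every window lies in the set, and every word of the set is the window at
-- exactly one position i. (Hence N equals the size of the set.)
IsUCycle : ∀ {A : Set} {N} (n : ℕ) → (Vec A n → Set) → Vec A N → Set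
IsUCycle n P x =
  ((i : _) → P (window n x i)) ×
  ((w : _) → P w → ∃ λ i → (window n x i ≡ w) × ((i' : _) → window n x i' ≡ w → i' ≡ i))

module Submission where

-- A shift bijection of a set S of words of length n is a permutation σ of all
-- words with σ (a ∷ Y) ≡ Y ∷ʳ c for some letter c, preserving S in both
-- directions.  Reading the first letters along a cycle of σ gives a cyclic
-- sequence whose n-windows are exactly the words of that cycle.  If the cycle of
-- a word z misses a word v ∈ S that agrees with some u on the cycle except in the
-- first letter, exchanging the successors of u and v joins the cycle of v onto
-- that of z.  Cycle lengths are bounded, so joining ends with a cycle of z that
-- is closed under such first-letter changes; if S is connected under shifts,
-- that cycle is all of S, and its letters form a U-cycle (cycle-joining).
--
-- For class alternating words of length m + 1 the map a ∷ Y ↦ Y ∷ʳ h a is a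
-- shift bijection when h is the identity (n even) or exchanges vowels and
-- consonants (n odd, k_v = k_c), and any two such words are connected by
-- sliding one into the other.  The theorem follows, the cases with an empty
-- class being trivial.

open import Data.Bool using (Bool; true; false; not; _xor_)
import Data.Bool.Properties as Bool
open import Data.Bool.Properties using (xor-same; ¬-not; xor-identityʳ; xor-inverseʳ
    ; not-involutive; not-distribˡ-xor; not-distribʳ-xor)
open import Data.List as List using (List; []; _∷_; _++_)
import Data.List.Properties as List
open import Data.Fin using (Fin; toℕ; fromℕ<; inject₁; combine)
  renaming (zero to fzero; suc to fsuc)
open import Data.Fin.Properties using (+↔⊎; inj⇒≟; any?; pigeonhole; toℕ<n; toℕ-fromℕ<
    ; toℕ-inject₁; toℕ-injective; combine-injective)
open import Data.Nat using (ℕ; zero; suc; _+_; _*_; _∸_; _^_; _≤_; _<_; _≤?_; _<?_; z≤n; s≤s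
    ; z<s; NonZero; >-nonZero)
open import Data.Nat.Divisibility using (_∣_; divides)
open import Data.Nat.DivMod using (_mod_; _%_; _/_; m≡m%n+[m/n]*n; m%n<n)
open import Data.Nat.GeneralisedArithmetic using (fold; fold-+)
open import Data.Nat.Induction using (<-rec)
open import Data.Nat.Properties using (anyUpTo?; suc-injective; +-comm; +-suc; +-identityʳ
    ; +-monoˡ-≤; +-cancelˡ-≤; +-cancelˡ-<; ≤-refl; ≤-trans; <-trans; ≤-<-trans; <-≤-trans
    ; <-irrefl; <⇒≤; <⇒≱; ≰⇒>; <-cmp; n<1+n; m<1+n⇒m<n∨m≡n; m≤n⇒∃[o]m+o≡n; m≤m+n; m≤n+m; m<m+n
    ; m<n+m; m≤m*n; m∸n≤m; m∸n+n≡m; m+[n∸m]≡n; m<n⇒0<n∸m)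
open import Data.Product using (∃; Σ; _×_; _,_; proj₁; proj₂)
open import Data.Sum using (_⊎_; inj₁; inj₂)
import Data.Sum as Sum
import Data.Sum.Properties as Sum
open import Data.Vec using (Vec; []; _∷_; head; tail; lookup; tabulate; _∷ʳ_; toList; init
    ; last; initLast)
open import Data.Vec.Properties using (init-∷ʳ; last-∷ʳ; cast-is-id; toList-∷ʳ
    ; toList-injective; length-toList; ∷ʳ-injectiveˡ; lookup∘tabulate; tabulate∘lookup
    ; tabulate-cong)
open import Function using (_∘_; id)
open import Function.Bundles using (_↣_; _↔_; Injection; Inverse; mk↣)
open import Function.Properties.Inverse using (↔⇒↣; ↔-sym)
open import Relation.Binary.Definitions using (DecidableEquality; tri<; tri≈; tri>)
open import Relation.Binary.PropositionalEquality
open import Relation.Nullary using (¬_; Dec; yes; no; contradiction; map′; _×-dec_; ¬?)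
open import Relation.Unary using (Decidable)

open import Defs using (Alphabet; isVowel; ClassAlternating; window; cyc; IsUCycle)

least-witness : {P : ℕ → Set} → Decidable P → ∀ {d} → P d →
                ∃ λ q → P q × (∀ {k} → k < q → ¬ P k)
least-witness {P} P? {d} = <-rec Least search d
  where
  Least : ℕ → Set
  Least d = P d → ∃ λ q → P q × (∀ {k} → k < q → ¬ P k)

  search : ∀ d → (∀ {k} → k < d → Least k) → Least d
  search d smaller Pd with anyUpTo? P? d
  ... | yes (k , k<d , Pk) = smaller k<d Pk
  ... | no none            = d , Pd , λ k<d Pk → none (_ , k<d , Pk)

iter : {A : Set} → (A → A) → ℕ → A → A
iter f k x = fold x f k

iter-+ : {A : Set} (f : A → A) (i j : ℕ) (x : A) → iter f (i + j) x ≡ iter f i (iter f j x)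
iter-+ f i j x = fold-+ x f i

iter-suc : {A : Set} (f : A → A) (k : ℕ) (x : A) → iter f (suc k) x ≡ iter f k (f x)
iter-suc f k x = trans (cong (λ t → iter f t x) (+-comm 1 k)) (iter-+ f k 1 x)

module Orbits {W : Set} {K : ℕ} (finite : W ↣ Fin K)
              (σ : W → W) (σ-injective : ∀ {a b} → σ a ≡ σ b → a ≡ b) where

  open Injection finite using (injective) renaming (to to encode)

  _≟_ : DecidableEquality W
  _≟_ = inj⇒≟ finite

  iter-injective : ∀ k {a b} → iter σ k a ≡ iter σ k b → a ≡ b
  iter-injective zero    e = e
  iter-injective (suc k) e = iter-injective k (σ-injective e)

  return-after : ∀ {a} i j → i < j → iter σ i a ≡ iter σ j a → iter σ (j ∸ i) a ≡ a
  return-after {a} i j i<j e = iter-injective i (begin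
    iter σ i (iter σ (j ∸ i) a)  ≡⟨ iter-+ σ i (j ∸ i) a ⟨
    iter σ (i + (j ∸ i)) a       ≡⟨ cong (λ t → iter σ t a) (m+[n∸m]≡n (<⇒≤ i<j)) ⟩
    iter σ j a                   ≡⟨ e ⟨
    iter σ i a                   ∎)
    where open ≡-Reasoning

  record Period (a : W) (q : ℕ) : Set where
    field
      positive : 0 < q
      returns  : iter σ q a ≡ a
      minimal  : ∀ {k} → 0 < k → k < q → iter σ k a ≢ a

  -- By pigeonhole among a, σ a, …, σ^K a, every point returns to itself.
  returns-somewhere : ∀ a → ∃ λ d → 0 < d × iter σ d a ≡ a
  returns-somewhere a with pigeonhole (n<1+n K) (λ (i : Fin (suc K)) → encode (iter σ (toℕ i) a))
  ... | i , j , i<j , e =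
    toℕ j ∸ toℕ i , m<n⇒0<n∸m i<j , return-after (toℕ i) (toℕ j) i<j (injective e)

  period-exists : ∀ a → ∃ (Period a)
  period-exists a
    with least-witness (λ k → 0 <? k ×-dec iter σ k a ≟ a) (proj₂ (returns-somewhere a))
  ... | q , (0<q , ret) , below =
    q , record { positive = 0<q ; returns = ret ; minimal = λ 0<k k<q e → below k<q (0<k , e) }

  period-bound : ∀ {a q} → Period a q → q ≤ K
  period-bound {a} {q} per with q ≤? K
  ... | yes q≤K = q≤K
  ... | no q≰K with pigeonhole (≰⇒> q≰K) (λ (i : Fin q) → encode (iter σ (toℕ i) a))
  ...   | i , j , i<j , e = contradiction (return-after (toℕ i) (toℕ j) i<j (injective e))
            (Period.minimal per (m<n⇒0<n∸m i<j) (≤-<-trans (m∸n≤m (toℕ j) (toℕ i)) (toℕ<n j)))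

  iter-multiple : ∀ {a q} → Period a q → ∀ c → iter σ (c * q) a ≡ a
  iter-multiple per zero = refl
  iter-multiple {a} {q} per (suc c) =
    trans (iter-+ σ q (c * q) a) (trans (cong (iter σ q) (iter-multiple per c)) (Period.returns per))

  rewind : ∀ {a q} → Period a q → ∀ j → iter σ (j * q ∸ j) (iter σ j a) ≡ a
  rewind {a} {q} per j = begin
    iter σ (j * q ∸ j) (iter σ j a)  ≡⟨ iter-+ σ (j * q ∸ j) j a ⟨
    iter σ (j * q ∸ j + j) a         ≡⟨ cong (λ t → iter σ t a) (m∸n+n≡m j≤jq) ⟩
    iter σ (j * q) a                 ≡⟨ iter-multiple per j ⟩
    a                                ∎
    where
    open ≡-Reasoning
    j≤jq : j ≤ j * q
    j≤jq = m≤m*n j q {{>-nonZero (Period.positive per)}}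

  module Cycle {z : W} {p : ℕ} (per : Period z p) where
    open Period per

    -- Needed to divide by p.
    instance
      p-nonZero : NonZero p
      p-nonZero = >-nonZero positive

    OnCycle : W → Set
    OnCycle w = ∃ λ k → k < p × iter σ k z ≡ w

    onCycle? : Decidable OnCycle
    onCycle? w = anyUpTo? (λ k → iter σ k z ≟ w) p

    onCycle-σ : ∀ {w} → OnCycle w → OnCycle (σ w)
    onCycle-σ (k , k<p , e) with m<1+n⇒m<n∨m≡n (s≤s k<p)
    ... | inj₁ 1+k<p = suc k , 1+k<p , cong σ e
    ... | inj₂ refl  = 0 , positive , trans (sym returns) (cong σ e)

    onCycle-iter : ∀ t → OnCycle (iter σ t z)
    onCycle-iter zero    = 0 , positive , refl
    onCycle-iter (suc t) = onCycle-σ (onCycle-iter t)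

    distinct : ∀ {i j} → i < j → j < p → iter σ i z ≢ iter σ j z
    distinct {i} {j} i<j j<p e =
      minimal (m<n⇒0<n∸m i<j) (≤-<-trans (m∸n≤m j i) j<p) (return-after i j i<j e)

    index-unique : ∀ {i j} → i < p → j < p → iter σ i z ≡ iter σ j z → i ≡ j
    index-unique {i} {j} i<p j<p e with <-cmp i j
    ... | tri< i<j _ _ = contradiction e (distinct i<j j<p)
    ... | tri≈ _ i≡j _ = i≡j
    ... | tri> _ _ j<i = contradiction (sym e) (distinct j<i i<p)

    iter-mod : ∀ r → iter σ (r % p) z ≡ iter σ r z
    iter-mod r = sym (begin
      iter σ r z                              ≡⟨ cong (λ t → iter σ t z) (m≡m%n+[m/n]*n r p) ⟩
      iter σ (r % p + r / p * p) z            ≡⟨ iter-+ σ (r % p) (r / p * p) z ⟩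
      iter σ (r % p) (iter σ (r / p * p) z)   ≡⟨ cong (iter σ (r % p)) (iter-multiple per (r / p)) ⟩
      iter σ (r % p) z                        ∎)
      where open ≡-Reasoning

module Transposition {W : Set} (_≟_ : DecidableEquality W) (a b : W) where

  swap : W → W
  swap w with w ≟ a | w ≟ b
  ... | yes _ | _     = b
  ... | no _  | yes _ = a
  ... | no _  | no _  = w

  swap-a : swap a ≡ b
  swap-a with a ≟ a
  ... | yes _   = refl
  ... | no a≢a  = contradiction refl a≢a

  swap-b : swap b ≡ a
  swap-b with b ≟ a | b ≟ b
  ... | yes b≡a | _      = b≡a
  ... | no _    | yes _  = refl
  ... | no _    | no b≢b = contradiction refl b≢b

  swap-other : ∀ {w} → w ≢ a → w ≢ b → swap w ≡ w
  swap-other {w} w≢a w≢b with w ≟ a | w ≟ b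
  ... | yes w≡a | _       = contradiction w≡a w≢a
  ... | no _    | yes w≡b = contradiction w≡b w≢b
  ... | no _    | no _    = refl

  swap-involutive : ∀ w → swap (swap w) ≡ w
  swap-involutive w with w ≟ a | w ≟ b
  ... | yes refl | _        = swap-b
  ... | no _     | yes refl = swap-a
  ... | no w≢a   | no w≢b   = swap-other w≢a w≢b

  swap-respects : {B : Set} (f : W → B) → f a ≡ f b → ∀ w → f (swap w) ≡ f w
  swap-respects f fa≡fb w with w ≟ a | w ≟ b
  ... | yes refl | _        = sym fa≡fb
  ... | no _     | yes refl = fa≡fb
  ... | no _     | no _     = refl

  swap-preserves : (P : W → Set) → P a → P b → ∀ {w} → P w → P (swap w)
  swap-preserves P Pa Pb {w} Pw with w ≟ a | w ≟ b
  ... | yes _ | _     = Pb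
  ... | no _  | yes _ = Pa
  ... | no _  | no _  = Pw

module Encoding {L : Set} {K : ℕ} (letters : L ↣ Fin K) where
  open Injection letters renaming (to to code; injective to code-injective)

  encode : ∀ {n} → Vec L n → Fin (K ^ n)
  encode []      = fzero
  encode (a ∷ w) = combine (code a) (encode w)

  encode-injective : ∀ {n} {v w : Vec L n} → encode v ≡ encode w → v ≡ w
  encode-injective {v = []}    {[]}    _ = refl
  encode-injective {v = a ∷ v} {b ∷ w} e with combine-injective (code a) (encode v) (code b) (encode w) e
  ... | a≡b , v≡w = cong₂ _∷_ (code-injective a≡b) (encode-injective v≡w)

  words↣ : ∀ n → Vec L n ↣ Fin (K ^ n)
  words↣ n = mk↣ encode-injective

any-letter? : {L : Set} {K : ℕ} → L ↔ Fin K → {P : L → Set} → Decidable P → Dec (∃ P)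
any-letter? alphabet {P} P? =
  map′ (λ (i , Pi) → from i , Pi)
       (λ (a , Pa) → to a , subst P (sym (strictlyInverseʳ a)) Pa)
       (any? (P? ∘ from))
  where open Inverse alphabet

lookup-∷ʳ : ∀ {A : Set} {n} (xs : Vec A n) (c : A) (j : Fin n) →
            lookup (xs ∷ʳ c) (inject₁ j) ≡ lookup xs j
lookup-∷ʳ (x ∷ xs) c fzero    = refl
lookup-∷ʳ (x ∷ xs) c (fsuc j) = lookup-∷ʳ xs c j

slide : ∀ {A : Set} {m k} → Vec A (suc m) → Vec A k → Vec A (suc m)
slide u []       = u
slide u (c ∷ cs) = slide (tail u ∷ʳ c) cs

toList-∷ʳ-++ : ∀ {A : Set} {m k} (u : Vec A m) (c : A) (cs : Vec A k) →
               toList (u ∷ʳ c) ++ toList cs ≡ toList u ++ (c ∷ toList cs)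
toList-∷ʳ-++ u c cs =
  trans (cong (_++ toList cs) (toList-∷ʳ c u)) (List.++-assoc (toList u) List.[ c ] (toList cs))

toList-slide : ∀ {A : Set} {m k} (u : Vec A (suc m)) (cs : Vec A k) →
               toList (slide u cs) ≡ List.drop k (toList u ++ toList cs)
toList-slide u        []       = sym (List.++-identityʳ (toList u))
toList-slide {k = suc k} (a ∷ u′) (c ∷ cs) =
  trans (toList-slide (u′ ∷ʳ c) cs) (cong (List.drop k) (toList-∷ʳ-++ u′ c cs))

drop-++ : ∀ {A : Set} (xs ys : List A) → List.drop (List.length xs) (xs ++ ys) ≡ ys
drop-++ []       ys = refl
drop-++ (x ∷ xs) ys = drop-++ xs ys

slide-self : ∀ {A : Set} {m} (u w : Vec A (suc m)) → slide u w ≡ w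
slide-self u w = trans (sym (cast-is-id refl (slide u w))) (toList-injective refl (slide u w) w (begin
  toList (slide u w)                                        ≡⟨ toList-slide u w ⟩
  List.drop (suc _) (toList u ++ toList w)
    ≡⟨ cong (λ k → List.drop k (toList u ++ toList w)) (sym (length-toList u)) ⟩
  List.drop (List.length (toList u)) (toList u ++ toList w) ≡⟨ drop-++ (toList u) (toList w) ⟩
  toList w                                                  ∎))
  where open ≡-Reasoning

init-last : ∀ {A : Set} {n} (y : Vec A (suc n)) → init y ∷ʳ last y ≡ y
init-last y = sym (proj₂ (proj₂ (initLast y)))

data Reach {L : Set} {n : ℕ} (S : Vec L (suc n) → Set) (u : Vec L (suc n)) : Vec L (suc n) → Set where
  here : Reach S u u
  step : ∀ {c w} → S (tail u ∷ʳ c) → Reach S (tail u ∷ʳ c) w → Reach S u w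

module CycleJoining {L : Set} {K : ℕ} (alphabet : L ↔ Fin K) (m : ℕ)
                    (S : Vec L (suc m) → Set) (S? : Decidable S) (z : Vec L (suc m)) (Sz : S z) where

  Word : Set
  Word = Vec L (suc m)

  -- There are at most K ^ (m + 1) words; this bounds the length of every cycle.
  finite : Word ↣ Fin (K ^ suc m)
  finite = Encoding.words↣ (↔⇒↣ alphabet) (suc m)

  -- A bijection of words that shifts every word by one letter and preserves S in
  -- both directions; its cycles are therefore cyclic sequences of letters.
  record ShiftBijection : Set where
    field
      σ τ         : Word → Word
      σ∘τ         : ∀ w → σ (τ w) ≡ w
      τ∘σ         : ∀ w → τ (σ w) ≡ w
      shifts      : ∀ w → ∃ λ c → σ w ≡ tail w ∷ʳ c
      σ-preserves : ∀ {w} → S w → S (σ w)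
      τ-preserves : ∀ {w} → S w → S (τ w)

    σ-injective : ∀ {a b} → σ a ≡ σ b → a ≡ b
    σ-injective {a} {b} e = trans (sym (τ∘σ a)) (trans (cong τ e) (τ∘σ b))

  module Shift (π : ShiftBijection) where
    open ShiftBijection π public
    open Orbits finite σ σ-injective public

    iter-preserves : ∀ k {w} → S w → S (iter σ k w)
    iter-preserves zero    Sw = Sw
    iter-preserves (suc k) Sw = σ-preserves (iter-preserves k Sw)

    head-iter : ∀ k (w : Word) (j : Fin (suc m)) → toℕ j ≡ k → head (iter σ k w) ≡ lookup w j
    head-iter zero    (a ∷ w) fzero    _ = refl
    head-iter (suc k) w       (fsuc j) e = begin
      head (iter σ (suc k) w)             ≡⟨ cong head (iter-suc σ k w) ⟩
      head (iter σ k (σ w))               ≡⟨ head-iter k (σ w) (inject₁ j) (trans (toℕ-inject₁ j) (suc-injective e)) ⟩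
      lookup (σ w) (inject₁ j)            ≡⟨ cong (λ y → lookup y (inject₁ j)) (proj₂ (shifts w)) ⟩
      lookup (tail w ∷ʳ _) (inject₁ j)    ≡⟨ lookup-∷ʳ (tail w) _ j ⟩
      lookup (tail w) j                   ≡⟨ lookup-tail w ⟩
      lookup w (fsuc j)                   ∎
      where
      open ≡-Reasoning
      lookup-tail : ∀ (y : Word) → lookup (tail y) j ≡ lookup y (fsuc j)
      lookup-tail (a ∷ y) = refl

    Closed : ∀ {p} → Period z p → Set
    Closed per = ∀ {u b} → OnCycle u → S (b ∷ tail u) → OnCycle (b ∷ tail u)
      where open Cycle per

    closed-reach : ∀ {p} (per : Period z p) → Closed per →
                   ∀ {u w} → Cycle.OnCycle per u → Reach S u w → Cycle.OnCycle per w
    closed-reach per closed u∈ here = u∈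
    closed-reach per closed {u} u∈ (step {c} Sy reach) = closed-reach per closed y∈ reach
      where
      open Cycle per
      y x : Word
      y = tail u ∷ʳ c
      x = τ y
      -- σ x ≡ y forces x to agree with u after the first letter.
      tail-x : tail x ≡ tail u
      tail-x = ∷ʳ-injectiveˡ (tail x) (tail u) (trans (sym (proj₂ (shifts x))) (σ∘τ y))
      x≡ : x ≡ head x ∷ tail u
      x≡ = trans (head-tail x) (cong (head x ∷_) tail-x)
        where head-tail : ∀ (w : Word) → w ≡ head w ∷ tail w
              head-tail (a ∷ w) = refl
      x∈ : OnCycle x
      x∈ = subst OnCycle (sym x≡) (closed u∈ (subst S x≡ (τ-preserves Sy)))
      y∈ : OnCycle y
      y∈ = subst OnCycle (σ∘τ y) (onCycle-σ x∈)

    cycle-letters : ∀ {p} → Period z p → Vec L p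
    cycle-letters {p} _ = tabulate (λ (k : Fin p) → head (iter σ (toℕ k) z))

    window-cycle : ∀ {p} (per : Period z (suc p)) i →
                   window (suc m) (cycle-letters per) i ≡ iter σ (toℕ i) z
    window-cycle {p} per i = trans (tabulate-cong letter) (tabulate∘lookup (iter σ (toℕ i) z))
      where
      open Cycle per
      open ≡-Reasoning
      letter : ∀ j → cyc (cycle-letters per) i (toℕ j) ≡ lookup (iter σ (toℕ i) z) j
      letter j = begin
        lookup (cycle-letters per) ((toℕ i + toℕ j) mod suc p)
          ≡⟨ lookup∘tabulate (λ (k : Fin (suc p)) → head (iter σ (toℕ k) z)) ((toℕ i + toℕ j) mod suc p) ⟩
        head (iter σ (toℕ ((toℕ i + toℕ j) mod suc p)) z)
          ≡⟨ cong (λ t → head (iter σ t z)) (toℕ-fromℕ< (m%n<n (toℕ i + toℕ j) (suc p))) ⟩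
        head (iter σ ((toℕ i + toℕ j) % suc p) z)
          ≡⟨ cong head (iter-mod (toℕ i + toℕ j)) ⟩
        head (iter σ (toℕ i + toℕ j) z)
          ≡⟨ cong (λ t → head (iter σ t z)) (+-comm (toℕ i) (toℕ j)) ⟩
        head (iter σ (toℕ j + toℕ i) z)
          ≡⟨ cong head (iter-+ σ (toℕ j) (toℕ i) z) ⟩
        head (iter σ (toℕ j) (iter σ (toℕ i) z))
          ≡⟨ head-iter (toℕ j) (iter σ (toℕ i) z) j refl ⟩
        lookup (iter σ (toℕ i) z) j ∎

    u-cycle : ∀ {p} (per : Period z p) → (∀ {w} → S w → Cycle.OnCycle per w) →
              ∃ λ N → Σ (Vec L N) λ x → IsUCycle (suc m) S x
    u-cycle {zero} per covers = contradiction (Period.positive per) (<-irrefl refl)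
    u-cycle {suc p} per covers = suc p , cycle-letters per , windows-in-S , words-once
      where
      open Cycle per
      windows-in-S : ∀ i → S (window (suc m) (cycle-letters per) i)
      windows-in-S i = subst S (sym (window-cycle per i)) (iter-preserves (toℕ i) Sz)
      words-once : ∀ w → S w → ∃ λ i → window (suc m) (cycle-letters per) i ≡ w ×
                   (∀ i′ → window (suc m) (cycle-letters per) i′ ≡ w → i′ ≡ i)
      words-once w Sw with covers Sw
      ... | k , k<p , e =
        fromℕ< k<p ,
        trans (window-cycle per (fromℕ< k<p)) (trans (cong (λ t → iter σ t z) (toℕ-fromℕ< k<p)) e) ,
        λ i′ e′ → toℕ-injective (trans
          (index-unique (toℕ<n i′) k<p (trans (sym (window-cycle per i′)) (trans e′ (sym e))))
          (sym (toℕ-fromℕ< k<p)))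

  -- Exchanging
  -- the successors of u and v gives a new shift bijection, under which z runs through
  -- its old cycle up to u, then through the whole cycle of v, and then back along
  -- the rest of its old cycle: z acquires the period p + q.
  module Join (π : ShiftBijection) {p} (per : Shift.Period π z p)
              {i} (i<p : i < p) {v : Word} (tails : tail v ≡ tail (iter (ShiftBijection.σ π) i z))
              (Sv : S v) (v-off : ¬ Shift.Cycle.OnCycle π per v)
              {q} (period-v : Shift.Period π v q) where
    open Shift π
    open Cycle per
    open Period per

    u : Word
    u = iter σ i z

    open Transposition _≟_ u v

    module V = Period period-v

    σ′ : Word → Word
    σ′ = σ ∘ swap

    joined : ShiftBijection
    joined = record
      { σ           = σ′
      ; τ           = swap ∘ τ
      ; σ∘τ         = λ y → trans (cong σ (swap-involutive (τ y))) (σ∘τ y)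
      ; τ∘σ         = λ w → trans (cong swap (τ∘σ (swap w))) (swap-involutive w)
      ; shifts      = λ w → let c , e = shifts (swap w) in
                            c , trans e (cong (_∷ʳ c) (swap-respects tail (sym tails) w))
      ; σ-preserves = λ Sw → σ-preserves (swap-preserves S (iter-preserves i Sz) Sv Sw)
      ; τ-preserves = λ Sy → swap-preserves S (iter-preserves i Sz) Sv (τ-preserves Sy)
      }

    σ′-other : ∀ {w} → w ≢ u → w ≢ v → σ′ w ≡ σ w
    σ′-other w≢u w≢v = cong σ (swap-other w≢u w≢v)

    v-orbit-off : ∀ j → ¬ OnCycle (iter σ j v)
    v-orbit-off j (k , k<p , e) = v-off (subst OnCycle v≡ (onCycle-iter (j * q ∸ j + k)))
      where
      v≡ : iter σ (j * q ∸ j + k) z ≡ v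
      v≡ = trans (iter-+ σ (j * q ∸ j) k z)
                 (trans (cong (iter σ (j * q ∸ j)) e) (rewind period-v j))

    trace-before : ∀ k → k ≤ i → iter σ′ k z ≡ iter σ k z
    trace-before zero    _     = refl
    trace-before (suc k) 1+k≤i = trans (cong σ′ (trace-before k (<⇒≤ 1+k≤i)))
      (σ′-other (distinct 1+k≤i i<p) (λ e → v-off (k , <-trans 1+k≤i i<p , e)))

    trace-detour : ∀ j → j < q → iter σ′ (suc (i + j)) z ≡ iter σ (suc j) v
    trace-detour zero _ = begin
      σ′ (iter σ′ (i + 0) z)  ≡⟨ cong (λ t → σ′ (iter σ′ t z)) (+-identityʳ i) ⟩
      σ′ (iter σ′ i z)        ≡⟨ cong σ′ (trace-before i ≤-refl) ⟩
      σ (swap u)              ≡⟨ cong σ swap-a ⟩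
      σ v                     ∎
      where open ≡-Reasoning
    trace-detour (suc j) 1+j<q = begin
      σ′ (iter σ′ (i + suc j) z)    ≡⟨ cong (λ t → σ′ (iter σ′ t z)) (+-suc i j) ⟩
      σ′ (iter σ′ (suc (i + j)) z)  ≡⟨ cong σ′ (trace-detour j (<-trans (n<1+n j) 1+j<q)) ⟩
      σ′ (iter σ (suc j) v)         ≡⟨ σ′-other (λ e → v-orbit-off (suc j) (i , i<p , sym e))
                                                (V.minimal z<s 1+j<q) ⟩
      σ (iter σ (suc j) v)          ∎
      where open ≡-Reasoning

    rejoin : iter σ′ (i + q) z ≡ v
    rejoin with m≤n⇒∃[o]m+o≡n V.positive
    ... | o , 1+o≡q = begin
      iter σ′ (i + q) z        ≡⟨ cong (λ t → iter σ′ (i + t) z) (sym 1+o≡q) ⟩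
      iter σ′ (i + suc o) z    ≡⟨ cong (λ t → iter σ′ t z) (+-suc i o) ⟩
      iter σ′ (suc (i + o)) z  ≡⟨ trace-detour o (subst (o <_) 1+o≡q ≤-refl) ⟩
      iter σ (suc o) v         ≡⟨ cong (λ t → iter σ t v) 1+o≡q ⟩
      iter σ q v               ≡⟨ V.returns ⟩
      v                        ∎
      where open ≡-Reasoning

    trace-after : ∀ t → i < t → t ≤ p → iter σ′ (t + q) z ≡ iter σ t z
    trace-after (suc t) i<1+t 1+t≤p with m<1+n⇒m<n∨m≡n i<1+t
    ... | inj₂ refl = trans (cong σ′ rejoin) (cong σ swap-b)
    ... | inj₁ i<t  = trans (cong σ′ (trace-after t i<t (<⇒≤ 1+t≤p)))
      (σ′-other (λ e → distinct i<t 1+t≤p (sym e)) (λ e → v-off (t , 1+t≤p , e)))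

    joined-minimal : ∀ {k} → 0 < k → k < p + q → iter σ′ k z ≢ z
    joined-minimal {k} 0<k k<p+q with k ≤? i | k ≤? i + q
    ... | yes k≤i | _ = λ e → minimal 0<k (≤-<-trans k≤i i<p) (trans (sym (trace-before k k≤i)) e)
    ... | no k≰i | yes k≤i+q with m≤n⇒∃[o]m+o≡n (≰⇒> k≰i)
    ...   | j , refl = λ e → v-orbit-off (suc j) (0 , positive , sym (trans (sym (trace-detour j j<q)) e))
      where
      j<q : j < q
      j<q = +-cancelˡ-≤ i (suc j) q (subst (_≤ i + q) (sym (+-suc i j)) k≤i+q)
    joined-minimal {k} 0<k k<p+q | no _ | no k≰i+q
      with m≤n⇒∃[o]m+o≡n (≤-trans (m≤n+m q i) (<⇒≤ (≰⇒> k≰i+q)))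
    ...   | t , refl = λ e → minimal (≤-<-trans z≤n i<t) t<p
              (trans (sym (trace-after t i<t (<⇒≤ t<p))) (trans (cong (λ s → iter σ′ s z) (+-comm t q)) e))
      where
      i<t : i < t
      i<t = +-cancelˡ-< q i t (subst (_< q + t) (+-comm i q) (≰⇒> k≰i+q))
      t<p : t < p
      t<p = +-cancelˡ-< q t p (subst (q + t <_) (+-comm p q) k<p+q)

    joined-period : Shift.Period joined z (p + q)
    joined-period = record
      { positive = ≤-trans positive (m≤m+n p q)
      ; returns  = trans (trace-after p i<p ≤-refl) returns
      ; minimal  = joined-minimal
      }

    grows : p < p + q
    grows = m<m+n p V.positive

  record ClosedCycle : Set where
    field
      bijection : ShiftBijection
      period    : ℕ
      cycle     : Shift.Period bijection z period
      closed    : Shift.Closed bijection cycle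

  -- Join cycles onto the cycle of z until it is closed.  Every join lengthens the
  -- cycle, whose length is bounded by the number K ^ (m + 1) of words, so the fuel
  -- guarantees termination.
  join-until-closed : ∀ fuel (π : ShiftBijection) {p} (per : Shift.Period π z p) →
                      K ^ suc m < p + fuel → ClosedCycle
  join-until-closed zero π {p} per bound =
    contradiction (Shift.period-bound π per) (<⇒≱ (subst (K ^ suc m <_) (+-identityʳ p) bound))
  join-until-closed (suc fuel) π {p} per bound with anyUpTo? exit? p
    where
    open Shift π
    open Cycle per
    Exit : ℕ → Set
    Exit i = ∃ λ b → S (b ∷ tail (iter σ i z)) × ¬ OnCycle (b ∷ tail (iter σ i z))
    exit? : Decidable Exit
    exit? i = any-letter? alphabet (λ b → S? _ ×-dec ¬? (onCycle? _))
  ... | yes (i , i<p , b , Sv , v-off) = join-until-closed fuel J.joined J.joined-period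
      (<-≤-trans (subst (K ^ suc m <_) (+-suc p fuel) bound) (+-monoˡ-≤ fuel J.grows))
    where
    module J = Join π per i<p refl Sv v-off (proj₂ (Shift.period-exists π _))
  ... | no no-exit = record { bijection = π ; period = p ; cycle = per ; closed = closed }
    where
    open Shift π
    open Cycle per
    closed : Closed per
    closed {u} {b} (k , k<p , e) Sbu with onCycle? (b ∷ tail u)
    ... | yes on = on
    ... | no off = contradiction (k , k<p , b , subst Conj (sym e) (Sbu , off)) no-exit
      where
      Conj : Word → Set
      Conj y = S (b ∷ tail y) × ¬ OnCycle (b ∷ tail y)

  cycle-joining : ShiftBijection → (∀ {w} → S w → Reach S z w) →
                  ∃ λ N → Σ (Vec L N) λ x → IsUCycle (suc m) S x
  cycle-joining π₀ reach = u-cycle cycle covers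
    where
    start : ∃ (Shift.Period π₀ z)
    start = Shift.period-exists π₀ z
    result : ClosedCycle
    result = join-until-closed (K ^ suc m) π₀ (proj₂ start)
                               (m<n+m (K ^ suc m) (Shift.Period.positive {π = π₀} (proj₂ start)))
    open ClosedCycle result
    open Shift bijection
    open Cycle cycle
    covers : ∀ {w} → S w → OnCycle w
    covers Sw = closed-reach cycle closed (0 , Period.positive cycle , refl) (reach Sw)

parity : ℕ → Bool
parity zero    = false
parity (suc k) = not (parity k)

parity-even : ∀ {n} → 2 ∣ n → parity n ≡ false
parity-even (divides q refl) = parity-double q
  where
  parity-double : ∀ q → parity (q * 2) ≡ false
  parity-double zero    = refl
  parity-double (suc q) = trans (not-involutive (parity (q * 2))) (parity-double q)

parity-odd : ∀ {n} → ¬ 2 ∣ n → parity n ≡ true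
parity-odd {n} 2∤n with parity n in e
... | true  = refl
... | false = contradiction (even n e) 2∤n
  where
  even : ∀ n → parity n ≡ false → 2 ∣ n
  even zero          _ = divides 0 refl
  even (suc (suc n)) e with even n (trans (sym (not-involutive (parity n))) e)
  ... | divides q n≡2q = divides (suc q) (cong (suc ∘ suc) n≡2q)

alternating : Bool → ℕ → List Bool
alternating c zero    = []
alternating c (suc k) = c ∷ alternating (not c) k

xor-not : ∀ c p → c xor not p ≡ not c xor p
xor-not c p = trans (sym (not-distribʳ-xor c p)) (not-distribˡ-xor c p)

xor-true⇒not : ∀ x y → x xor y ≡ true → y ≡ not x
xor-true⇒not true  false _ = refl
xor-true⇒not false true  _ = refl

xor-flip : ∀ c p → (c xor p) xor not p ≡ not c
xor-flip true  true  = refl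
xor-flip true  false = refl
xor-flip false true  = refl
xor-flip false false = refl

empty-u-cycle : {A : Set} {n : ℕ} {P : Vec A n → Set} → (∀ w → ¬ P w) →
                ∃ λ N → Σ (Vec A N) λ x → IsUCycle n P x
empty-u-cycle none = 0 , [] , (λ ()) , λ w Pw → contradiction Pw (none w)

module Alternation (kv kc : ℕ) where

  Letter : Set
  Letter = Alphabet kv kc

  class : Letter → Bool
  class = isVowel

  CA : ∀ {n} → Vec Letter n → Set
  CA {n} = ClassAlternating {kv} {kc} {n}

  alphabet : Letter ↔ Fin (kv + kc)
  alphabet = ↔-sym +↔⊎

  CA-[] : CA []
  CA-[] ()

  CA-[a] : ∀ a → CA (a ∷ [])
  CA-[a] a fzero fzero ()

  CA-uncons : ∀ {n a b} {w : Vec Letter n} → CA (a ∷ b ∷ w) → class a xor class b ≡ true × CA (b ∷ w)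
  CA-uncons ca = ca fzero (fsuc fzero) refl , λ i j j≡1+i → ca (fsuc i) (fsuc j) (cong suc j≡1+i)

  CA-cons : ∀ {n a b} {w : Vec Letter n} → class a xor class b ≡ true → CA (b ∷ w) → CA (a ∷ b ∷ w)
  CA-cons ab ca fzero    (fsuc fzero) _     = ab
  CA-cons ab ca (fsuc i) (fsuc j)     j≡1+i = ca i j (suc-injective j≡1+i)
  CA-cons ab ca fzero    fzero        ()
  CA-cons ab ca fzero    (fsuc (fsuc j)) ()
  CA-cons ab ca (fsuc i) fzero        ()

  AltFrom : Bool → List Letter → Set
  AltFrom c xs = List.map class xs ≡ alternating c (List.length xs)

  alt-cons : ∀ {c x xs} → class x ≡ c → AltFrom (not c) xs → AltFrom c (x ∷ xs)
  alt-cons = cong₂ _∷_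

  alt-uncons : ∀ {c x xs} → AltFrom c (x ∷ xs) → class x ≡ c × AltFrom (not c) xs
  alt-uncons = List.∷-injective

  alt-++ : ∀ c xs ys → AltFrom c xs → AltFrom (c xor parity (List.length xs)) ys → AltFrom c (xs ++ ys)
  alt-++ c []       ys _   alt-ys = subst (λ d → AltFrom d ys) (xor-identityʳ c) alt-ys
  alt-++ c (x ∷ xs) ys alt alt-ys = alt-cons (proj₁ (alt-uncons {x = x} alt))
    (alt-++ (not c) xs ys (proj₂ (alt-uncons {x = x} alt))
            (subst (λ d → AltFrom d ys) (xor-not c (parity (List.length xs))) alt-ys))

  alt-prefix : ∀ c xs ys → AltFrom c (xs ++ ys) → AltFrom c xs
  alt-prefix c []       ys _   = refl
  alt-prefix c (x ∷ xs) ys alt = alt-cons (proj₁ (alt-uncons {x = x} alt))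
                                          (alt-prefix (not c) xs ys (proj₂ (alt-uncons {x = x} alt)))

  alt-suffix : ∀ c xs ys → AltFrom c (xs ++ ys) → AltFrom (c xor parity (List.length xs)) ys
  alt-suffix c []       ys alt = subst (λ d → AltFrom d ys) (sym (xor-identityʳ c)) alt
  alt-suffix c (x ∷ xs) ys alt = subst (λ d → AltFrom d ys) (sym (xor-not c (parity (List.length xs))))
                                       (alt-suffix (not c) xs ys (proj₂ (alt-uncons {x = x} alt)))

  CA⇒alt : ∀ {n} (w : Vec Letter (suc n)) → CA w → AltFrom (class (head w)) (toList w)
  CA⇒alt (a ∷ [])    _  = refl
  CA⇒alt (a ∷ b ∷ w) ca with CA-uncons ca
  ... | ab , ca-bw = alt-cons refl
    (subst (λ d → AltFrom d (toList (b ∷ w))) (xor-true⇒not (class a) (class b) ab) (CA⇒alt (b ∷ w) ca-bw))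

  alt⇒CA : ∀ {n} c (w : Vec Letter n) → AltFrom c (toList w) → CA w
  alt⇒CA c []          _   = CA-[]
  alt⇒CA c (a ∷ [])    _   = CA-[a] a
  alt⇒CA c (a ∷ b ∷ w) alt =
    CA-cons (subst₂ (λ x y → x xor y ≡ true) (sym a-c) (sym b-notc) (xor-inverseʳ c))
            (alt⇒CA (not c) (b ∷ w) alt-bw)
    where
    a-c : class a ≡ c
    a-c = proj₁ (alt-uncons {x = a} alt)
    alt-bw : AltFrom (not c) (toList (b ∷ w))
    alt-bw = proj₂ (alt-uncons {x = a} alt)
    b-notc : class b ≡ not c
    b-notc = proj₁ (alt-uncons {x = b} alt-bw)

  Alternating : List Letter → Set
  Alternating xs = ∃ λ c → AltFrom c xs

  alternating? : Decidable Alternating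
  alternating? xs with List.≡-dec Bool._≟_ (List.map class xs) (alternating true (List.length xs))
                     | List.≡-dec Bool._≟_ (List.map class xs) (alternating false (List.length xs))
  ... | yes from-true | _            = yes (true , from-true)
  ... | no _          | yes from-false = yes (false , from-false)
  ... | no ¬true      | no ¬false    = no λ { (true , alt) → ¬true alt ; (false , alt) → ¬false alt }

  CA? : ∀ {n} → Decidable (CA {suc n})
  CA? w = map′ (λ (c , alt) → alt⇒CA c w alt) (λ ca → class (head w) , CA⇒alt w ca) (alternating? (toList w))

  slide-reach : ∀ {m k} (u : Vec Letter (suc m)) (cs : Vec Letter k) →
                Alternating (toList u ++ toList cs) → Reach CA u (slide u cs)
  slide-reach u        []       _        = here
  slide-reach (a ∷ u′) (c ∷ cs) (d , alt) =
    step (alt⇒CA (not d) (u′ ∷ʳ c) (alt-prefix (not d) (toList (u′ ∷ʳ c)) (toList cs) alt′))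
         (slide-reach (u′ ∷ʳ c) cs (not d , alt′))
    where
    alt′ : AltFrom (not d) (toList (u′ ∷ʳ c) ++ toList cs)
    alt′ = subst (AltFrom (not d)) (sym (toList-∷ʳ-++ u′ c cs)) (proj₂ (alt-uncons {x = a} alt))

  extend : ∀ {m} {u : Vec Letter (suc m)} {ys} → CA u →
           AltFrom (class (head u) xor parity (suc m)) ys → Alternating (toList u ++ ys)
  extend {m} {u} {ys} ca-u alt-ys = class (head u) , alt-++ _ (toList u) ys (CA⇒alt u ca-u)
    (subst (λ k → AltFrom (class (head u) xor parity k) ys) (sym (length-toList u)) alt-ys)

  -- Any class alternating word can be reached from any other: slide in the target,
  -- preceded by its second letter if the classes would otherwise clash at the junction.
  connected : ∀ {m} {u w : Vec Letter (suc m)} → CA u → CA w → Reach CA u w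
  connected {zero}  {a ∷ []} {b ∷ []} _ _ = step (CA-[a] b) here
  connected {suc m} {u} {w₀ ∷ w₁ ∷ w″} ca-u ca-w
    with class w₀ Bool.≟ (class (head u) xor parity (suc (suc m)))
  ... | yes matches = subst (Reach CA u) (slide-self u w)
          (slide-reach u w (extend ca-u (subst (λ d → AltFrom d (toList w)) matches (CA⇒alt w ca-w))))
    where
    w : Vec Letter (suc (suc m))
    w = w₀ ∷ w₁ ∷ w″
  ... | no clashes = subst (Reach CA u) (slide-self (tail u ∷ʳ w₁) w)
          (slide-reach u (w₁ ∷ w) (extend ca-u (alt-cons w₁-next
            (subst (λ d → AltFrom d (toList w)) (¬-not clashes) (CA⇒alt w ca-w)))))
    where
    w : Vec Letter (suc (suc m))
    w = w₀ ∷ w₁ ∷ w″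
    w₁-next : class w₁ ≡ class (head u) xor parity (suc (suc m))
    w₁-next = trans (xor-true⇒not (class w₀) (class w₁) (proj₁ (CA-uncons ca-w)))
                    (trans (cong not (¬-not clashes)) (not-involutive _))

  monochrome : ∀ {c} → (∀ a → class a ≡ c) → ∀ {n} (w : Vec Letter (suc (suc n))) → ¬ CA w
  monochrome {c} same (a ∷ b ∷ w) ca with trans (sym (cong₂ _xor_ (same a) (same b))) (proj₁ (CA-uncons ca))
  ... | c-xor-c≡true = contradiction (trans (sym (xor-same c)) c-xor-c≡true) λ ()

  zigzag : Fin kv → Fin kc → Bool → ∀ k → Vec Letter k
  zigzag v c d zero    = []
  zigzag v c d (suc k) = letter d ∷ zigzag v c (not d) k
    where
    letter : Bool → Letter
    letter true  = inj₁ v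
    letter false = inj₂ c

  zigzag-alternates : ∀ v c d k → AltFrom d (toList (zigzag v c d k))
  zigzag-alternates v c d       zero    = refl
  zigzag-alternates v c true  (suc k) = alt-cons {x = inj₁ v} refl (zigzag-alternates v c false k)
  zigzag-alternates v c false (suc k) = alt-cons {x = inj₂ c} refl (zigzag-alternates v c true k)

  module ShiftBy (m : ℕ) (h : Letter → Letter) (h-involutive : ∀ a → h (h a) ≡ a)
                 (h-class : ∀ a → class (h a) ≡ class a xor parity (suc m)) where

    σ₀ τ₀ : Vec Letter (suc m) → Vec Letter (suc m)
    σ₀ (a ∷ Y) = Y ∷ʳ h a
    τ₀ y       = h (last y) ∷ init y

    σ₀∘τ₀ : ∀ y → σ₀ (τ₀ y) ≡ y
    σ₀∘τ₀ y = trans (cong (init y ∷ʳ_) (h-involutive (last y))) (init-last y)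

    τ₀∘σ₀ : ∀ w → τ₀ (σ₀ w) ≡ w
    τ₀∘σ₀ (a ∷ Y) = cong₂ _∷_ (trans (cong h (last-∷ʳ (h a) Y)) (h-involutive a)) (init-∷ʳ (h a) Y)

    -- Appending h a continues the pattern of a ∷ Y, as h a has the class that
    -- follows the last letter of Y.
    σ₀-preserves : ∀ w → CA w → CA (σ₀ w)
    σ₀-preserves (a ∷ Y) ca = alt⇒CA (not (class a)) (Y ∷ʳ h a)
      (subst (AltFrom (not (class a))) (sym (toList-∷ʳ (h a) Y))
             (alt-++ (not (class a)) (toList Y) List.[ h a ] alt-Y (alt-cons h-a refl)))
      where
      alt-Y : AltFrom (not (class a)) (toList Y)
      alt-Y = proj₂ (alt-uncons {x = a} (CA⇒alt (a ∷ Y) ca))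
      h-a : class (h a) ≡ not (class a) xor parity (List.length (toList Y))
      h-a = trans (h-class a) (trans (xor-not (class a) (parity m))
                                     (cong (λ k → not (class a) xor parity k) (sym (length-toList Y))))

    -- Dually, h (last y) has the class that precedes the first letter of y.
    τ₀-preserves : ∀ y → CA y → CA (τ₀ y)
    τ₀-preserves y ca = alt⇒CA (not c) (τ₀ y) (alt-cons h-last
      (subst (λ d → AltFrom d (toList (init y))) (sym (not-involutive c)) (alt-prefix c _ _ alt)))
      where
      c : Bool
      c = class (head y)
      alt : AltFrom c (toList (init y) ++ List.[ last y ])
      alt = subst (AltFrom c) (trans (cong toList (sym (init-last y))) (toList-∷ʳ (last y) (init y))) (CA⇒alt y ca)
      last-class : class (last y) ≡ c xor parity m
      last-class = trans (proj₁ (alt-uncons {x = last y} (alt-suffix c (toList (init y)) _ alt)))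
                         (cong (λ k → c xor parity k) (length-toList (init y)))
      h-last : class (h (last y)) ≡ not c
      h-last = trans (h-class (last y)) (trans (cong (_xor parity (suc m)) last-class) (xor-flip c (parity m)))

  u-cycle-by-shift : ∀ m → Fin kv → Fin kc →
                     (h : Letter → Letter) → (∀ a → h (h a) ≡ a) →
                     (∀ a → class (h a) ≡ class a xor parity (suc m)) →
                     ∃ λ N → Σ (Vec Letter N) λ x → IsUCycle (suc m) CA x
  u-cycle-by-shift m v c h h-involutive h-class = cycle-joining shift (connected z-CA)
    where
    z : Vec Letter (suc m)
    z = zigzag v c true (suc m)
    z-CA : CA z
    z-CA = alt⇒CA true z (zigzag-alternates v c true (suc m))
    open CycleJoining alphabet m CA CA? z z-CA
    open ShiftBy m h h-involutive h-class
    shift : ShiftBijection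
    shift = record
      { σ = σ₀ ; τ = τ₀ ; σ∘τ = σ₀∘τ₀ ; τ∘σ = τ₀∘σ₀
      ; shifts = λ { (a ∷ Y) → h a , refl }
      ; σ-preserves = λ {w} → σ₀-preserves w ; τ-preserves = λ {y} → τ₀-preserves y }

UCycleExists : ℕ → ℕ → ℕ → Set
UCycleExists n kv kc = ∃ λ N → Σ (Vec (Alphabet kv kc) N) λ x → IsUCycle n (ClassAlternating {kv} {kc} {n}) x

-- Even length: h is the identity.  If one class is empty there are no words at all.
even-length : ∀ m kv kc → parity (suc m) ≡ false → UCycleExists (suc m) kv kc
even-length zero    _       _       ()
even-length (suc m) zero    kc      _    = empty-u-cycle (Alternation.monochrome zero kc all-consonants)
  where
  all-consonants : ∀ (a : Alphabet zero kc) → isVowel a ≡ false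
  all-consonants (inj₂ _) = refl
even-length (suc m) (suc a) zero    _    = empty-u-cycle (Alternation.monochrome (suc a) zero all-vowels)
  where
  all-vowels : ∀ (x : Alphabet (suc a) zero) → isVowel x ≡ true
  all-vowels (inj₁ _) = refl
even-length (suc m) (suc a) (suc b) even =
  Alternation.u-cycle-by-shift (suc a) (suc b) (suc m) fzero fzero id (λ _ → refl)
    (λ x → sym (trans (cong (isVowel x xor_) even) (xor-identityʳ (isVowel x))))

odd-length : ∀ m k → parity (suc m) ≡ true → UCycleExists (suc m) k k
odd-length m zero    _   = empty-u-cycle λ { (inj₁ () ∷ _) ; (inj₂ () ∷ _) }
odd-length m (suc k) odd =
  Alternation.u-cycle-by-shift (suc k) (suc k) m fzero fzero Sum.swap Sum.swap-involutive
    (λ x → trans (exchange-class x) (cong (isVowel x xor_) (sym odd)))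
  where
  exchange-class : ∀ (x : Alphabet (suc k) (suc k)) → isVowel (Sum.swap x) ≡ isVowel x xor true
  exchange-class (inj₁ _) = refl
  exchange-class (inj₂ _) = refl

theorem4 : (n kv kc : ℕ) → 1 ≤ n →
    (2 ∣ n ⊎ ((¬ 2 ∣ n) × kv ≡ kc)) →
    ∃ λ N → Σ (Vec (Alphabet kv kc) N) λ x →
      IsUCycle n (ClassAlternating {kv} {kc} {n}) x
theorem4 zero    _  _  ()
theorem4 (suc m) kv kc _ (inj₁ 2∣n)          = even-length m kv kc (parity-even 2∣n)
theorem4 (suc m) kv kc _ (inj₂ (2∤n , refl)) = odd-length m kv (parity-odd 2∤n)
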